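{- For any two product states $s=(\vec q,P,\Phi)$ and $t=(\vec r,S,\Psi)$ of $\mathcal A^e\times\overline B$ such that $\vec q=\vec r$, $P\supseteq S$ and $\Phi\rightarrow\Psi$ is valid, we have $\mathcal L_s(\mathcal A^e\times\overline B)\subseteq\mathcal L_t(\mathcal A^e\times\overline B)$; that is, the relation $\sqsubseteq_{\mathit{img}}$ defined by $(\vec q,P,\Phi)\sqsubseteq_{\mathit{img}}(\vec r,S,\Psi)$ iff $\vec q=\vec r$, $P\supseteq S$ and $\Phi\rightarrow\Psi$ is a subsumption.
   Context: Data automata (DA): $\mathcal{D}$ is a data domain with first-order theory $\mathrm{Th}(\mathcal D)$ closed under conjunction and negation; a DA $\langle\mathcal D,\Sigma,\vec x,Q,\iota,F,\Delta\rangle$ has finite alphabet $\Sigma$ containing padding symbol $\diamond$, finite variables $\vec x$, finite states $Q$, initial $\iota$, final $F\subseteq Q$, and rules $q\xrightarrow{\sigma,\phi(\vec x,\vec x')}q'$ with $\phi\in\mathrm{Th}(\mathcal D)$. A trace is $(\nu_0,\sigma_0),\dots,(\nu_{n-1},\sigma_{n-1}),(\nu_n,\diamond)$ with valuations $\nu_i\in\mathcal D^{\vec x}$; a run over it from $(q_0,\nu_0)$ is $(q_0,\nu_0)\xrightarrow{\sigma_0}\cdots(q_n,\nu_n)$ with a rule $q_i\xrightarrow{\sigma_i,\phi}q_{i+1}$ and $(\nu_i,\nu_{i+1})\models\phi$ for each $i$; accepting if $q_n\in F$. The residual language $\mathcal L_{(q,\nu)}(A)$ is the set of traces (whose first valuation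 is $\nu$) having an accepting run starting in $(q,\nu)$. Network $\mathcal A=\langle A_1,\dots,A_N\rangle$, $A_i=\langle\mathcal D,\Sigma_i,\vec x_i,Q_i,\iota_i,F_i,\Delta_i\rangle$ with disjoint state sets; expansion $\mathcal A^e$: variables $\vec x_{\mathcal A}=\bigcup\vec x_i$, states $Q_1\times\dots\times Q_N$, final $F_1\times\dots\times F_N$, rules $\langle q_1,\dots,q_N\rangle\xrightarrow{\sigma,\varphi}\langle q_1',\dots,q_N'\rangle$ where with $I$ the indices $i$ having a rule $q_i\xrightarrow{\sigma,\varphi_i}q_i'\in\Delta_i$, $q_j=q_j'$ for $j\notin I$ and $\varphi\equiv\bigwedge_{i\in I}\varphi_i\wedge\bigwedge_{j\notin I}\bigwedge_{x\in\vec x_j\setminus\bigcup_{i\in I}\vec x_i}x'=x$. Observer DA $B=\langle\mathcal D,\Sigma,\vec x_B,Q_B,\iota_B,F_B,\Delta_B\rangle$, $\vec x_B\subseteq\vec x_{\mathcal A}$; complement $\overline B$ with states $2^{Q_B}$, final states $\{P\mid P\cap F_B=\emptyset\}$, rules $P\xrightarrow{\sigma,\theta}P'$ whenever every $p'\in P'$ has a $\sigma$-rule from some $p\in P$, with $\theta\equiv\bigwedge_{p'\in P'}\bigvee_{p\in P,\,p\xrightarrow{\sigma,\psi}p'\in\Delta_B}\psi\wedge\bigwedge_{p'\notin P'}\bigwedge_{p\in P,\,p\xrightarrow{\sigma,\varphi}p'\in\Delta_B}\neg\varphi$. Product $\mathcal A^e\times\overline B$: variables $\vec x_{\mathcal A}$,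 states $(\vec q,P)$, final states $(F_1\times\dots\times F_N)\times\{P\mid P\cap F_B=\emptyset\}$, rules $(\vec q,P)\xrightarrow{\sigma,\varphi\wedge\theta}(\vec q',P')$ for rules $\vec q\xrightarrow{\sigma,\varphi}\vec q'$ of $\mathcal A^e$ and $P\xrightarrow{\sigma,\theta}P'$ of $\overline B$. A product state $s=(\vec q,P,\Phi)$ with $\Phi(\vec x_{\mathcal A})\in\mathrm{Th}(\mathcal D)$ denotes $[\![s]\!]=\{(\vec q,P,\nu)\mid\nu\models\Phi\}$, and $\mathcal L_s(\mathcal A^e\times\overline B)=\bigcup_{(\vec q,P,\nu)\in[\![s]\!]}\mathcal L_{(\vec q,P,\nu)}(\mathcal A^e\times\overline B)$. A partial order $\sqsubseteq$ on product states is a subsumption if $s\sqsubseteq t$ implies $\mathcal L_s(\mathcal A^e\times\overline B)\subseteq\mathcal L_t(\mathcal A^e\times\overline B)$. -}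

module Defs where

open import Data.Nat using (ℕ)
open import Data.Bool using (Bool; true; false)
open import Data.Fin using (Fin)
open import Data.Fin.Subset using (Subset; _∈_; _∉_; _⊆_; _∩_; Empty)
open import Data.List using (List)
open import Data.List.Membership.Propositional using () renaming (_∈_ to _∈ₗ_)
open import Data.List.Relation.Unary.All using (All)
open import Data.Product using (Σ; ∃; _×_; _,_)
open import Relation.Binary.PropositionalEquality using (_≡_)
open import Relation.Nullary using (¬_)
open import Data.Unit using (⊤)

-- Conventions:
--  * the data domain is an arbitrary type D; a formula of Th(D) over the
--    variables X is modelled semantically by its (classical, two-valued)
--    truth function on valuations X → D;
--  * alphabets are subsets of a global finite letter set Fin k with a
--    fixed padding letter ⋄;
--  * the global variable set x_A is Fin m; every automaton's variables
--    are a subset of it.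

Vars : {m : ℕ} → Subset m → Set
Vars {m} s = Σ (Fin m) (λ v → v ∈ s)

restrict : {D : Set} {m : ℕ} (s : Subset m) → (Fin m → D) → (Vars s → D)
restrict s ν (v , _) = ν v

record Rule (D : Set) (k : ℕ) (X : Set) (n : ℕ) : Set where
  constructor rule
  field
    src : Fin n
    lab : Fin k
    fml : (X → D) → (X → D) → Bool
    tgt : Fin n

record DA (D : Set) (k : ℕ) (⋄ : Fin k) (X : Set) : Set where
  field
    Σₐ    : Subset k
    ⋄∈Σ   : ⋄ ∈ Σₐ
    n     : ℕ
    ι     : Fin n
    F     : Subset n
    Δ     : List (Rule D k X n)
    labΣ  : All (λ r → Rule.lab r ∈ Σₐ) Δ

open Rule public
open DA public

-- The product A^e × complement(B) for a network A = ⟨A_1..A_N⟩ and an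
-- observer B.

module Product
  {D : Set} {k : ℕ} {⋄ : Fin k} {N m : ℕ}
  (vars  : Fin N → Subset m)
  (A     : (i : Fin N) → DA D k ⋄ (Vars (vars i)))
  (varsB : Subset m)
  (B     : DA D k ⋄ (Vars varsB))
  where

  Val : Set
  Val = Fin m → D

  Letter : Set
  Letter = Fin k

  QVec : Set
  QVec = (i : Fin N) → Fin (n (A i))

  -- a rule ⟨q_i⟩ --σ,φ--> ⟨q'_i⟩ of A^e: I is the set of indices whose
  -- component has a σ-rule from q_i; each of them takes one, the others idle
  record ExpRule (q : QVec) (σ : Letter) (q' : QVec) : Set where
    field
      I      : Subset N
      pick   : (i : Fin N) → i ∈ I →
               Σ (Rule D k (Vars (vars i)) (n (A i))) λ r →
                 r ∈ₗ Δ (A i) × src r ≡ q i × lab r ≡ σ × tgt r ≡ q' i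
      idle   : (j : Fin N) → j ∉ I → q' j ≡ q j
      noRule : (j : Fin N) → j ∉ I →
               (r : Rule D k (Vars (vars j)) (n (A j))) → r ∈ₗ Δ (A j) →
               src r ≡ q j → ¬ (lab r ≡ σ)

  -- (ν,ν') ⊨ φ  where  φ ≡ ⋀_{i∈I} φ_i ∧ ⋀_{j∉I} ⋀_{x ∈ x_j \ ⋃_{i∈I} x_i} x' = x
  ExpSat : {q : QVec} {σ : Letter} {q' : QVec} → ExpRule q σ q' → Val → Val → Set
  ExpSat e ν ν' =
    ((i : Fin N) (i∈I : i ∈ I) →
       let (r , _) = pick i i∈I in
       fml r (restrict (vars i) ν) (restrict (vars i) ν') ≡ true)
    ×
    ((j : Fin N) → j ∉ I → (x : Fin m) → x ∈ vars j →
       ¬ (∃ λ i → i ∈ I × x ∈ vars i) → ν' x ≡ ν x)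
    where open ExpRule e

  RuleB : Set
  RuleB = Rule D k (Vars varsB) (n B)

  CompRule : Subset (n B) → Letter → Subset (n B) → Set
  CompRule P σ P' = (p' : Fin (n B)) → p' ∈ P' →
    Σ RuleB λ r → r ∈ₗ Δ B × src r ∈ P × lab r ≡ σ × tgt r ≡ p'

  -- (ν,ν') ⊨ θ  where
  -- θ ≡ ⋀_{p'∈P'} ⋁_{p∈P, p-σ,ψ->p'} ψ ∧ ⋀_{p'∉P'} ⋀_{p∈P, p-σ,φ->p'} ¬φ
  CompSat : Subset (n B) → Letter → Subset (n B) → Val → Val → Set
  CompSat P σ P' ν ν' =
    ((p' : Fin (n B)) → p' ∈ P' →
       Σ RuleB λ r → r ∈ₗ Δ B × src r ∈ P × lab r ≡ σ × tgt r ≡ p' ×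
         fml r (restrict varsB ν) (restrict varsB ν') ≡ true)
    ×
    ((p' : Fin (n B)) → p' ∉ P' → (r : RuleB) → r ∈ₗ Δ B →
       src r ∈ P → lab r ≡ σ → tgt r ≡ p' →
         fml r (restrict varsB ν) (restrict varsB ν') ≡ false)

  PState : Set
  PState = QVec × Subset (n B)

  FinalP : PState → Set
  FinalP (q , P) = ((i : Fin N) → q i ∈ F (A i)) × Empty (P ∩ F B)

  Step : PState → Letter → PState → Val → Val → Set
  Step (q , P) σ (q' , P') ν ν' =
    Σ (ExpRule q σ q') λ e → ExpSat e ν ν' × CompRule P σ P' × CompSat P σ P' ν ν'

  -- traces (ν_0,σ_0),…,(ν_{n-1},σ_{n-1}),(ν_n,⋄)
  data Trace : Set where
    end  : Val → Trace
    _◂_  : Val × Letter → Trace → Trace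

  first : Trace → Val
  first (end ν)         = ν
  first ((ν , _) ◂ τ)   = ν

  -- all non-padding letters belong to the alphabet Σ of the product (= Σ of B)
  OverΣ : Trace → Set
  OverΣ (end _)         = ⊤
  OverΣ ((_ , σ) ◂ τ)   = σ ∈ Σₐ B × OverΣ τ

  data Accepting : PState → Trace → Set where
    acc-end  : ∀ {s ν} → FinalP s → Accepting s (end ν)
    acc-step : ∀ {s s' ν σ τ} → Step s σ s' ν (first τ) →
               Accepting s' τ → Accepting s ((ν , σ) ◂ τ)

  Lres : PState → Val → Trace → Set
  Lres s ν τ = first τ ≡ ν × OverΣ τ × Accepting s τ

  record SState : Set where
    constructor sstate
    field
      qs  : QVec
      Ps  : Subset (n B)
      Φ   : Val → Bool

  L : SState → Trace → Set
  L (sstate q P Φ) τ = Σ Val λ ν → Φ ν ≡ true × Lres (q , P) ν τ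

  _⊑img_ : SState → SState → Set
  sstate q P Φ ⊑img sstate r S Ψ =
    q ≡ r × S ⊆ P × ((ν : Val) → Φ ν ≡ true → Ψ ν ≡ true)

-- a network: the union of the component variable sets is the whole x_A
Covers : {N m : ℕ} → (Fin N → Subset m) → Set
Covers {N} {m} vars = (x : Fin m) → ∃ λ (i : Fin N) → x ∈ vars i

module Submission where

-- The complement of the observer B is a subset construction, and
-- its accepting condition "P ∩ F_B = ∅" is antitone in P.  Whenever the
-- product takes a step  (q,P) --σ--> (q',P')  under valuations (ν,ν'), the
-- product state (q,S) with S ⊆ P can take the same A^e-step and move to the image
--   post S σ ν ν' = { p' | some σ-rule p → p' with p ∈ S is enabled by (ν,ν') },
-- which is a legal complement transition and satisfies post S ⊆ P' (every
-- state outside P' is reached from P only by disabled rules).  By induction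
-- on the trace, accepting runs from (q,P) thus transfer to (q,S)
-- (accepting-antitone).  The theorem follows: a trace of L_s starts in some
-- ν ⊨ Φ, and Φ → Ψ gives ν ⊨ Ψ, so the same trace lies in L_t.

open import Defs
open import Data.Nat using (ℕ)
open import Data.Bool using (Bool; true; false)
open import Data.Bool.Properties using () renaming (_≟_ to _≟ᵇ_)
open import Data.Fin using (Fin)
open import Data.Fin.Properties using (_≟_)
open import Data.Fin.Subset using (Subset; _∈_; _∉_; _⊆_; _∩_; Empty)
open import Data.Fin.Subset.Properties using (_∈?_; x∈p∩q⁺; x∈p∩q⁻)
open import Data.Vec using (tabulate)
open import Data.Vec.Properties using ([]=⇒lookup; lookup⇒[]=; lookup∘tabulate)
open import Data.List.Relation.Unary.Any using (Any; any?)
open import Data.List.Membership.Propositional using (find; lose)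
  renaming (_∈_ to _∈ₗ_)
open import Data.Product using (Σ; _×_; _,_)
open import Level using (Level)
open import Relation.Nullary using (Dec; yes; no; does; _×-dec_; contradiction)
open import Relation.Nullary.Decidable using (dec-true)
open import Relation.Unary using (Pred; Decidable)
open import Relation.Binary.PropositionalEquality using (_≡_; refl; sym; trans)

private
  variable
    ℓ : Level
    c : ℕ

does-true⇒ : {A : Set ℓ} (a? : Dec A) → does a? ≡ true → A
does-true⇒ (yes a) _ = a

comprehension : {P : Pred (Fin c) ℓ} → Decidable P → Subset c
comprehension P? = tabulate (λ x → does (P? x))

∈-comprehension⁺ : {P : Pred (Fin c) ℓ} (P? : Decidable P) {x : Fin c} →
                   P x → x ∈ comprehension P?
∈-comprehension⁺ P? {x} Px =
  lookup⇒[]= x _ (trans (lookup∘tabulate _ x) (dec-true (P? x) Px))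

∈-comprehension⁻ : {P : Pred (Fin c) ℓ} (P? : Decidable P) {x : Fin c} →
                   x ∈ comprehension P? → P x
∈-comprehension⁻ P? {x} x∈ =
  does-true⇒ (P? x) (trans (sym (lookup∘tabulate _ x)) ([]=⇒lookup x∈))

-- Disjointness from a fixed set F is inherited by subsets; this is why the
-- final states  P ∩ F_B = ∅  of the complement are closed under shrinking P.
Empty-∩-antitone : {S P F : Subset c} → S ⊆ P → Empty (P ∩ F) → Empty (S ∩ F)
Empty-∩-antitone {S = S} {F = F} S⊆P P∩F-empty (x , x∈S∩F) =
  let (x∈S , x∈F) = x∈p∩q⁻ S F x∈S∩F
  in P∩F-empty (x , x∈p∩q⁺ (S⊆P x∈S , x∈F))

module Subsumption
  {D : Set} {k : ℕ} {⋄ : Fin k} {N m : ℕ}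
  (vars  : Fin N → Subset m)
  (A     : (i : Fin N) → DA D k ⋄ (Vars (vars i)))
  (varsB : Subset m)
  (B     : DA D k ⋄ (Vars varsB))
  where
  open Product vars A varsB B

  holds : RuleB → Val → Val → Bool
  holds r ν ν' = fml r (restrict varsB ν) (restrict varsB ν')

  Enables : Subset (n B) → Letter → Val → Val → Fin (n B) → RuleB → Set
  Enables S σ ν ν' p' r =
    src r ∈ S × lab r ≡ σ × tgt r ≡ p' × holds r ν ν' ≡ true

  enables? : ∀ S σ ν ν' p' → Decidable (Enables S σ ν ν' p')
  enables? S σ ν ν' p' r =
    (src r ∈? S) ×-dec (lab r ≟ σ) ×-dec (tgt r ≟ p') ×-dec (holds r ν ν' ≟ᵇ true)

  post : Subset (n B) → Letter → Val → Val → Subset (n B)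
  post S σ ν ν' = comprehension (λ p' → any? (enables? S σ ν ν' p') (Δ B))

  post-witness : ∀ {S σ ν ν' p'} → p' ∈ post S σ ν ν' →
                 Σ RuleB λ r → r ∈ₗ Δ B × Enables S σ ν ν' p' r
  post-witness {S} {σ} {ν} {ν'} {p'} p'∈ =
    find (∈-comprehension⁻ (λ p' → any? (enables? S σ ν ν' p') (Δ B)) p'∈)

  post-rule : ∀ S σ ν ν' → CompRule S σ (post S σ ν ν')
  post-rule S σ ν ν' p' p'∈ =
    let (r , r∈Δ , src∈S , lab≡σ , tgt≡p' , _) = post-witness p'∈
    in r , r∈Δ , src∈S , lab≡σ , tgt≡p'

  -- … and its guard θ holds: states inside the image have an enabled rule
  -- from S, states outside it are reached only by disabled rules.
  post-sat : ∀ S σ ν ν' → CompSat S σ (post S σ ν ν') ν ν'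
  post-sat S σ ν ν' = (λ p' p'∈ → post-witness p'∈) , outside
    where
    outside : (p' : Fin (n B)) → p' ∉ post S σ ν ν' → (r : RuleB) → r ∈ₗ Δ B →
              src r ∈ S → lab r ≡ σ → tgt r ≡ p' → holds r ν ν' ≡ false
    outside p' p'∉ r r∈Δ src∈S lab≡σ tgt≡p' with holds r ν ν' in guard
    ... | false = refl
    ... | true  = contradiction
      (∈-comprehension⁺ (λ p' → any? (enables? S σ ν ν' p') (Δ B))
                        (lose r∈Δ (src∈S , lab≡σ , tgt≡p' , guard)))
      p'∉

  -- The image of S ⊆ P is contained in every complement successor P' of P:
  -- a state reached from S by an enabled rule cannot lie outside P', since
  -- θ forces all rules from P into the complement of P' to be disabled.
  post-least : ∀ {S P P' σ ν ν'} → S ⊆ P → CompSat P σ P' ν ν' →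
               post S σ ν ν' ⊆ P'
  post-least {P' = P'} S⊆P (_ , outside) {p'} p'∈ with p' ∈? P'
  ... | yes p'∈P' = p'∈P'
  ... | no  p'∉P' =
    let (r , r∈Δ , src∈S , lab≡σ , tgt≡p' , guard) = post-witness p'∈
    in contradiction (trans (sym guard) (outside p' p'∉P' r r∈Δ (S⊆P src∈S) lab≡σ tgt≡p'))
                     (λ ())

  -- Run transfer: an accepting run from (q,P) yields one from (q,S) for any
  -- S ⊆ P, following the same A^e-steps and replacing each complement step
  -- by the image transition.
  accepting-antitone : ∀ {q P S} τ → S ⊆ P → Accepting (q , P) τ → Accepting (q , S) τ
  accepting-antitone (end ν) S⊆P (acc-end (q-final , P∩F-empty)) =
    acc-end (q-final , Empty-∩-antitone S⊆P P∩F-empty)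
  accepting-antitone {S = S} ((ν , σ) ◂ τ) S⊆P
                     (acc-step (e , e-sat , _ , θ-sat) run) =
    acc-step (e , e-sat , post-rule S σ ν (first τ) , post-sat S σ ν (first τ))
             (accepting-antitone τ (post-least S⊆P θ-sat) run)

lemma4 : {D : Set} {k : ℕ} {⋄ : Fin k} {N m : ℕ}
         (vars : Fin N → Subset m) → Covers vars →
         (A : (i : Fin N) → DA D k ⋄ (Vars (vars i))) →
         (varsB : Subset m) (B : DA D k ⋄ (Vars varsB)) →
         let open Product vars A varsB B in
         (s t : SState) → s ⊑img t →
         (τ : Trace) → L s τ → L t τ
lemma4 vars _ A varsB B (Product.sstate q P Φ) (Product.sstate .q S Ψ)
       (refl , S⊆P , Φ⇒Ψ) τ (ν , Φν , first≡ν , overΣ , run) =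
  ν , Φ⇒Ψ ν Φν , first≡ν , overΣ , accepting-antitone τ S⊆P run
  where open Subsumption vars A varsB B
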